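{- For every positive integer $n$ satisfying at least one of $n\equiv 6 \pmod 8$, $n\equiv 0\pmod 8$, or $n\equiv 0\pmod{17}$, there exists a regular $K_4$-saturated graph on $n$ vertices.
   Context: A graph is $K_4$-saturated if it contains no $K_4$ (complete graph on 4 vertices) but adding any edge between two non-adjacent vertices creates a $K_4$. -}

module Defs where

open import Data.Nat using (ℕ; zero; suc; _+_; _%_)
open import Data.Bool using (Bool; true; false; _∨_; _∧_)
open import Data.Fin using (Fin)
open import Data.Fin.Properties using (_≟_)
open import Data.List using (List; filter; length)
open import Data.List using () renaming (allFin to allFinL)
open import Data.Product using (Σ; ∃; _×_; _,_)
open import Relation.Nullary using (¬_; does)
open import Relation.Binary.PropositionalEquality using (_≡_; _≢_)

record Graph (n : ℕ) : Set where
  field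
    adj   : Fin n → Fin n → Bool
    sym   : ∀ u v → adj u v ≡ adj v u
    irrefl : ∀ v → adj v v ≡ false
open Graph public

_~[_]_ : {n : ℕ} → Fin n → Graph n → Fin n → Set
u ~[ G ] v = adj G u v ≡ true

-- A copy of K4 in an adjacency function: four pairwise adjacent vertices
-- (pairwise adjacency forces distinctness in a loopless graph, but we
-- also demand distinctness explicitly for the general adjacency function).
HasK4 : {n : ℕ} → (Fin n → Fin n → Bool) → Set
HasK4 {n} a = Σ (Fin n) λ x → Σ (Fin n) λ y → Σ (Fin n) λ z → Σ (Fin n) λ w →
  (x ≢ y) × (x ≢ z) × (x ≢ w) × (y ≢ z) × (y ≢ w) × (z ≢ w) ×
  (a x y ≡ true) × (a x z ≡ true) × (a x w ≡ true) ×
  (a y z ≡ true) × (a y w ≡ true) × (a z w ≡ true)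

addEdge : {n : ℕ} → Graph n → Fin n → Fin n → (Fin n → Fin n → Bool)
addEdge G u v x y =
  adj G x y ∨ ((does (x ≟ u) ∧ does (y ≟ v)) ∨ (does (x ≟ v) ∧ does (y ≟ u)))

K4Saturated : {n : ℕ} → Graph n → Set
K4Saturated {n} G =
  ¬ HasK4 (adj G) ×
  (∀ (u v : Fin n) → u ≢ v → adj G u v ≡ false → HasK4 (addEdge G u v))

degree : {n : ℕ} → Graph n → Fin n → ℕ
degree {n} G v = length (filter (λ w → adj G v w Data.Bool.≟ true) (allFinL n))

Regular : {n : ℕ} → Graph n → Set
Regular {n} G = Σ ℕ λ d → ∀ (v : Fin n) → degree G v ≡ d

-- For n = 8c and n = 17c, blow up (replace every vertex by c independent copies) the 5-regular
-- K4-saturated complement of C₃ + C₅, resp. the 8-regular Paley graph on 17 vertices.  Projecting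
-- to the base graph shows that the blow-up is K4-free and multiplies degrees by c; a missing edge of
-- the blow-up lies over a missing edge or over a single vertex of the base, and in both cases the
-- base supplies two adjacent common neighbours, since every base vertex lies in a triangle.
--
-- For n = 8k + 6, put the vertices at positions 0, …, n − 1, give position i the label ⌊i/2⌋ mod 4
-- and join i < j exactly when label j − label i is 1 or 2 (mod 4).  The neighbours preceding a
-- vertex carry only two labels while adjacent vertices carry different labels, so the last vertex of
-- a K4 cannot exist.  A non-adjacent pair i < j has label j = label i or label j = label i − 1, and
-- two adjacent common neighbours are found at fixed small offsets before i, between i and j, or after
-- j; the last works because the labels end with a complete pair labelled 2.  Each block of eight
-- consecutive positions carries every label twice, so counting block by block gives every vertex
-- degree 4(k + 1).

module Submission where

open import Defs hiding (sym)
open import Data.Bool using (Bool; true; false; _∧_; _∨_; not; if_then_else_; T)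
import Data.Bool as 𝔹
open import Data.Bool.ListAction using (all; any)
open import Data.Bool.Properties using (T-≡; T-not-≡)
open import Data.Empty using (⊥; ⊥-elim)
open import Data.Fin
  using (Fin; zero; suc; toℕ; fromℕ<; splitAt; _↑ˡ_; _↑ʳ_; quotient; remainder; combine)
open import Data.Fin.Properties
  using (toℕ<n; toℕ-injective; toℕ-fromℕ<; splitAt-↑ʳ; remQuot-combine)
  renaming (_≟_ to _≟ᶠ_)
open import Data.List using (List; []; _∷_; allFin; filter; length; tabulate)
open import Data.List.Membership.Propositional.Properties using (∈-allFin)
open import Data.List.Relation.Unary.All using () renaming (lookup to lookupAll)
open import Data.List.Relation.Unary.All.Properties using (all⁺)
open import Data.List.Relation.Unary.Any using (satisfied)
open import Data.List.Relation.Unary.Any.Properties using (any⁻)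
open import Data.Nat
  using (ℕ; zero; suc; _+_; _*_; _∸_; _%_; _/_; _<_; _≤_; _<ᵇ_; _≤ᵇ_; _≡ᵇ_; _⊔_; z≤n; s≤s; NonZero)
open import Data.Nat.DivMod using (m≡m%n+[m/n]*n)
open import Data.Nat.Properties
  using (+-assoc; ≡ᵇ⇒≡; <⇒<ᵇ; <ᵇ⇒<; ≤ᵇ⇒≤; <-asym; ≤-refl; ≤-trans; <-trans; <-≤-trans;
         n≤1+n; m≤m+n; ≤∧≢⇒<; ⊔-sel; m≤m⊔n; m≤n⊔m; <-cmp; +-monoʳ-≤;
         +-commutativeSemigroup; module ≤-Reasoning)
open import Algebra.Properties.CommutativeSemigroup +-commutativeSemigroup
  using (x∙yz≈y∙xz; x∙yz≈xz∙y)
open import Data.Product using (Σ; ∃; _×_; _,_; proj₂)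
open import Data.Sum using (_⊎_; inj₁; inj₂)
open import Data.Unit using (tt)
open import Function using (_∘_; id)
open import Function.Bundles using (Equivalence)
open import Relation.Binary.Definitions using (tri<; tri≈; tri>)
open import Relation.Binary.PropositionalEquality
  using (_≡_; _≢_; refl; sym; trans; cong; cong₂; subst; subst₂; module ≡-Reasoning)
open import Relation.Nullary using (¬_; does; yes; no)
open import Relation.Nullary.Decidable using (⌊_⌋; toWitness; dec-true)

bit : Bool → ℕ
bit true  = 1
bit false = 0

count : ∀ {n} → (Fin n → Bool) → ℕ
count {zero}  f = 0
count {suc n} f = bit (f zero) + count (f ∘ suc)

count-cong : ∀ {n} {f g : Fin n → Bool} → (∀ i → f i ≡ g i) → count f ≡ count g
count-cong {zero}  eq = refl
count-cong {suc n} eq = cong₂ _+_ (cong bit (eq zero)) (count-cong (eq ∘ suc))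

count-++ : ∀ m {n} (f : Fin (m + n) → Bool) →
           count f ≡ count (f ∘ (_↑ˡ n)) + count (f ∘ (m ↑ʳ_))
count-++ zero    f = refl
count-++ (suc m) f =
  trans (cong (bit (f zero) +_) (count-++ m (f ∘ suc))) (sym (+-assoc (bit (f zero)) _ _))

length-filter-tabulate : ∀ {n m} (f : Fin m → Bool) (g : Fin n → Fin m) →
  length (filter (λ w → f w 𝔹.≟ true) (tabulate g)) ≡ count (f ∘ g)
length-filter-tabulate {zero}  f g = refl
length-filter-tabulate {suc n} f g with f (g zero)
... | true  = cong suc (length-filter-tabulate f (g ∘ suc))
... | false = length-filter-tabulate f (g ∘ suc)

degree≡count : ∀ {n} (G : Graph n) v → degree G v ≡ count (adj G v)
degree≡count G v = length-filter-tabulate (adj G v) id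

adjacent⇒≢ : ∀ {n} (G : Graph n) {u v} → u ~[ G ] v → u ≢ v
adjacent⇒≢ G {u} u~v refl with trans (sym u~v) (irrefl G u)
... | ()

HasK4-map : ∀ {n m} {G : Graph n} (H : Graph m) (f : Fin n → Fin m) →
  (∀ {x y} → x ~[ G ] y → f x ~[ H ] f y) → HasK4 (adj G) → HasK4 (adj H)
HasK4-map {G = G} H f hom (x , y , z , w , _ , _ , _ , _ , _ , _ , xy , xz , xw , yz , yw , zw) =
  f x , f y , f z , f w ,
  distinct xy , distinct xz , distinct xw , distinct yz , distinct yw , distinct zw ,
  hom xy , hom xz , hom xw , hom yz , hom yw , hom zw
  where
  distinct : ∀ {a b} → a ~[ G ] b → f a ≢ f b
  distinct e = adjacent⇒≢ H (hom e)

CommonEdge : ∀ {n} → Graph n → Fin n → Fin n → Set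
CommonEdge {n} G u v = Σ (Fin n) λ y → Σ (Fin n) λ z →
  u ~[ G ] y × u ~[ G ] z × v ~[ G ] y × v ~[ G ] z × y ~[ G ] z

commonEdge⇒K4 : ∀ {n} (G : Graph n) {u v} → u ≢ v → CommonEdge G u v → HasK4 (addEdge G u v)
commonEdge⇒K4 G {u} {v} u≢v (y , z , uy , uz , vy , vz , yz) =
  u , v , y , z ,
  u≢v , adjacent⇒≢ G uy , adjacent⇒≢ G uz ,
  adjacent⇒≢ G vy , adjacent⇒≢ G vz , adjacent⇒≢ G yz ,
  new-edge , old uy , old uz , old vy , old vz , old yz
  where
  old : ∀ {a b} → a ~[ G ] b → addEdge G u v a b ≡ true
  old {a} {b} e rewrite e = refl
  new-edge : addEdge G u v u v ≡ true
  new-edge rewrite dec-true (u ≟ᶠ u) refl | dec-true (v ≟ᶠ v) refl with adj G u v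
  ... | true  = refl
  ... | false = refl

commonEdges⇒K4Saturated : ∀ {n} (G : Graph n) → ¬ HasK4 (adj G) →
  (∀ u v → u ≢ v → adj G u v ≡ false → CommonEdge G u v) → K4Saturated G
commonEdges⇒K4Saturated G K4-free common =
  K4-free , λ u v u≢v u≁v → commonEdge⇒K4 G u≢v (common u v u≢v u≁v)

RegularK4Saturated : ℕ → Set
RegularK4Saturated n = Σ (Graph n) λ G → Regular G × K4Saturated G

-- Allowing a ≡ b demands a triangle through every vertex, which is what completes two copies of
-- one vertex in a blow-up.
StronglySaturated : ∀ {m} → Graph m → Set
StronglySaturated {m} B = ∀ a b → adj B a b ≡ false → CommonEdge B a b

-- Blow-ups

module BlowUp {m} (B : Graph m) where

  class : ∀ c → Fin (c * m) → Fin m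
  class c = remainder {c} m

  blowUp : ∀ c → Graph (c * m)
  blowUp c = record
    { adj    = λ x y → adj B (class c x) (class c y)
    ; sym    = λ x y → Graph.sym B (class c x) (class c y)
    ; irrefl = λ x → irrefl B (class c x)
    }

  class-combine : ∀ {c} (i : Fin c) a → class c (combine i a) ≡ a
  class-combine i a = cong proj₂ (remQuot-combine i a)

  class-↑ʳ : ∀ c (x : Fin (c * m)) → class (suc c) (m ↑ʳ x) ≡ class c x
  class-↑ʳ c x rewrite splitAt-↑ʳ m (c * m) x = refl

  count-class : ∀ c (P : Fin m → Bool) → count (P ∘ class c) ≡ c * count P
  count-class zero    P = refl
  count-class (suc c) P = begin
    count (P ∘ class (suc c))
      ≡⟨ count-++ m (P ∘ class (suc c)) ⟩
    count (P ∘ class (suc c) ∘ (_↑ˡ c * m)) + count (P ∘ class (suc c) ∘ (m ↑ʳ_))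
      ≡⟨ cong₂ _+_ (count-cong (cong P ∘ class-combine zero))
                   (count-cong (cong P ∘ class-↑ʳ c)) ⟩
    count P + count (P ∘ class c)
      ≡⟨ cong (count P +_) (count-class c P) ⟩
    count P + c * count P ∎
    where open ≡-Reasoning

  blowUp-regular : Regular B → ∀ c → Regular (blowUp c)
  blowUp-regular (d , regular) c = c * d , λ x → begin
    degree (blowUp c) x                 ≡⟨ degree≡count (blowUp c) x ⟩
    count (adj B (class c x) ∘ class c) ≡⟨ count-class c (adj B (class c x)) ⟩
    c * count (adj B (class c x))       ≡⟨ cong (c *_) (trans (sym (degree≡count B _)) (regular _)) ⟩
    c * d                               ∎
    where open ≡-Reasoning

  blowUp-K4-free : ¬ HasK4 (adj B) → ∀ c → ¬ HasK4 (adj (blowUp c))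
  blowUp-K4-free K4-free c = K4-free ∘ HasK4-map {G = blowUp c} B (class c) id

  blowUp-commonEdge : StronglySaturated B → ∀ c u v →
    adj (blowUp c) u v ≡ false → CommonEdge (blowUp c) u v
  blowUp-commonEdge complete c u v u≁v with complete (class c u) (class c v) u≁v
  ... | y , z , uy , uz , vy , vz , yz =
    combine i y , combine i z , lift uy , lift uz , lift vy , lift vz , lift² yz
    where
    i = quotient {c} m u
    lift : ∀ {a b} → adj B a b ≡ true → adj B a (class c (combine i b)) ≡ true
    lift {a} e = subst (λ t → adj B a t ≡ true) (sym (class-combine i _)) e
    lift² : ∀ {a b} → adj B a b ≡ true →
            adj B (class c (combine i a)) (class c (combine i b)) ≡ true
    lift² e = subst₂ (λ s t → adj B s t ≡ true) (sym (class-combine i _)) (sym (class-combine i _)) e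

  blowUp-K4Saturated : ¬ HasK4 (adj B) → StronglySaturated B → ∀ c → K4Saturated (blowUp c)
  blowUp-K4Saturated K4-free complete c =
    commonEdges⇒K4Saturated (blowUp c) (blowUp-K4-free K4-free c)
      (λ u v _ → blowUp-commonEdge complete c u v)

  blowUp-regularK4Saturated : Regular B → ¬ HasK4 (adj B) → StronglySaturated B →
    ∀ c → RegularK4Saturated (c * m)
  blowUp-regularK4Saturated regular K4-free complete c =
    blowUp c , blowUp-regular regular c , blowUp-K4Saturated K4-free complete c

-- The two base graphs, certified by evaluation

every : ∀ {n} → (Fin n → Bool) → Bool
every {n} f = all f (allFin n)

some : ∀ {n} → (Fin n → Bool) → Bool
some {n} f = any f (allFin n)

every-sound : ∀ {n} (f : Fin n → Bool) → T (every f) → ∀ i → T (f i)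
every-sound f holds i = lookupAll (all⁺ f _ holds) (∈-allFin i)

some-sound : ∀ {n} (f : Fin n → Bool) → T (some f) → ∃ (T ∘ f)
some-sound {n} f holds = satisfied (any⁻ f (allFin n) holds)

module Certified {m} (E : Fin m → Fin m → Bool) (d : ℕ)
  (symmetric : T (every λ a → every λ b → ⌊ E a b 𝔹.≟ E b a ⌋))
  (loopless  : T (every λ a → not (E a a)))
  (K4-free   : T (every λ a → every λ b → every λ c →
                    not (E a b ∧ E a c ∧ E b c) ∨ every λ e → not (E a e ∧ E b e ∧ E c e)))
  (completable : T (every λ a → every λ b →
                    E a b ∨ some λ y → some λ z → E a y ∧ E a z ∧ E b y ∧ E b z ∧ E y z))
  (regular   : T (every λ a → count (E a) ≡ᵇ d))
  where

  graph : Graph m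
  graph = record
    { adj    = E
    ; sym    = λ a b → toWitness {a? = E a b 𝔹.≟ E b a} (every-sound _ (every-sound _ symmetric a) b)
    ; irrefl = λ a → Equivalence.to T-not-≡ (every-sound _ loopless a)
    }

  private
    triangle : ∀ {p q r X} → p ≡ true → q ≡ true → r ≡ true →
               T (not (p ∧ q ∧ r) ∨ X) → T X
    triangle refl refl refl holds = holds

    no-apex : ∀ {p q r} → p ≡ true → q ≡ true → r ≡ true → ¬ T (not (p ∧ q ∧ r))
    no-apex refl refl refl ()

    non-edge : ∀ {p X} → p ≡ false → T (p ∨ X) → T X
    non-edge refl holds = holds

    conjuncts : ∀ {p q r s t} → T (p ∧ q ∧ r ∧ s ∧ t) →
                p ≡ true × q ≡ true × r ≡ true × s ≡ true × t ≡ true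
    conjuncts {true} {true} {true} {true} {true} _ = refl , refl , refl , refl , refl

  graph-K4-free : ¬ HasK4 E
  graph-K4-free (a , b , c , e , _ , _ , _ , _ , _ , _ , ab , ac , ae , bc , be , ce) =
    no-apex ae be ce (every-sound _ (triangle ab ac bc checked) e)
    where checked = every-sound _ (every-sound _ (every-sound _ K4-free a) b) c

  graph-stronglySaturated : StronglySaturated graph
  graph-stronglySaturated a b a≁b
    with some-sound _ (non-edge a≁b (every-sound _ (every-sound _ completable a) b))
  ... | y , holds with some-sound _ holds
  ... | z , holds′ = y , z , conjuncts holds′

  graph-regular : Regular graph
  graph-regular = d , λ a → trans (degree≡count graph a) (≡ᵇ⇒≡ _ _ (every-sound _ regular a))

  blowUps : ∀ c → RegularK4Saturated (c * m)
  blowUps = BlowUp.blowUp-regularK4Saturated graph graph-regular graph-K4-free graph-stronglySaturated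

circulant : ∀ n .{{_ : NonZero n}} → List ℕ → Fin n → Fin n → Bool
circulant n S i j = any (_≡ᵇ (n + toℕ j ∸ toℕ i) % n) S

-- Three independent vertices joined to a 5-cycle, i.e. the complement of C₃ + C₅.
threeJoinC₅ : Fin 8 → Fin 8 → Bool
threeJoinC₅ x y with splitAt 3 x | splitAt 3 y
... | inj₁ _ | inj₁ _ = false
... | inj₂ i | inj₂ j = circulant 5 (1 ∷ 4 ∷ []) i j
... | _      | _      = true

-- 1, 2, 4, 8, 9, 13, 15, 16 are the nonzero squares modulo 17.
paley₁₇ : Fin 17 → Fin 17 → Bool
paley₁₇ = circulant 17 (1 ∷ 2 ∷ 4 ∷ 8 ∷ 9 ∷ 13 ∷ 15 ∷ 16 ∷ [])

module ThreeJoinC₅ = Certified threeJoinC₅ 5 tt tt tt tt tt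
module Paley₁₇ = Certified paley₁₇ 8 tt tt tt tt tt

-- The ordered graphs on 8k + 6 vertices

next : Fin 4 → Fin 4
next zero                   = suc zero
next (suc zero)             = suc (suc zero)
next (suc (suc zero))       = suc (suc (suc zero))
next (suc (suc (suc zero))) = zero

fin4-cases : {P : Fin 4 → Set} →
  P zero → P (suc zero) → P (suc (suc zero)) → P (suc (suc (suc zero))) → ∀ a → P a
fin4-cases p₀ p₁ p₂ p₃ zero                   = p₀
fin4-cases p₀ p₁ p₂ p₃ (suc zero)             = p₁
fin4-cases p₀ p₁ p₂ p₃ (suc (suc zero))       = p₂
fin4-cases p₀ p₁ p₂ p₃ (suc (suc (suc zero))) = p₃

next⁴ : ∀ a → next (next (next (next a))) ≡ a
next⁴ = fin4-cases refl refl refl refl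

next-injective : ∀ {a b} → next a ≡ next b → a ≡ b
next-injective {a} {b} e = trans (sym (next⁴ a)) (trans (cong (next ∘ next ∘ next) e) (next⁴ b))

next-injective² : ∀ {a b} → next (next a) ≡ next (next b) → a ≡ b
next-injective² = next-injective ∘ next-injective

follows : Fin 4 → Fin 4 → Bool
follows a b = does (next a ≟ᶠ b) ∨ does (next (next a) ≟ᶠ b)

follows-next : ∀ a → follows a (next a) ≡ true
follows-next = fin4-cases refl refl refl refl

follows-next² : ∀ a → follows a (next (next a)) ≡ true
follows-next² = fin4-cases refl refl refl refl

follows-irrefl : ∀ a → follows a a ≡ false
follows-irrefl = fin4-cases refl refl refl refl

follows-false : ∀ a b → follows a b ≡ false → b ≡ a ⊎ next b ≡ a
follows-false = fin4-cases
  (fin4-cases (λ _ → inj₁ refl) (λ ()) (λ ()) (λ _ → inj₂ refl))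
  (fin4-cases (λ _ → inj₂ refl) (λ _ → inj₁ refl) (λ ()) (λ ()))
  (fin4-cases (λ ()) (λ _ → inj₂ refl) (λ _ → inj₁ refl) (λ ()))
  (fin4-cases (λ ()) (λ ()) (λ _ → inj₂ refl) (λ _ → inj₁ refl))

follows-into : ∀ {a b} → follows b a ≡ true → next b ≡ a ⊎ next (next b) ≡ a
follows-into {a} {b} h with next b ≟ᶠ a | next (next b) ≟ᶠ a
follows-into h  | yes e | _     = inj₁ e
follows-into h  | no _  | yes e = inj₂ e
follows-into () | no _  | no _

two-predecessors : ∀ {a b c d} →
  follows b a ≡ true → follows c a ≡ true → follows d a ≡ true → b ≡ c ⊎ b ≡ d ⊎ c ≡ d
two-predecessors hb hc hd with follows-into hb | follows-into hc | follows-into hd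
... | inj₁ b₁ | inj₁ c₁ | _       = inj₁ (next-injective (trans b₁ (sym c₁)))
... | inj₂ b₂ | inj₂ c₂ | _       = inj₁ (next-injective² (trans b₂ (sym c₂)))
... | inj₁ b₁ | inj₂ _  | inj₁ d₁ = inj₂ (inj₁ (next-injective (trans b₁ (sym d₁))))
... | inj₂ b₂ | inj₁ _  | inj₂ d₂ = inj₂ (inj₁ (next-injective² (trans b₂ (sym d₂))))
... | inj₁ _  | inj₂ c₂ | inj₂ d₂ = inj₂ (inj₂ (next-injective² (trans c₂ (sym d₂))))
... | inj₂ _  | inj₁ c₁ | inj₁ d₁ = inj₂ (inj₂ (next-injective (trans c₁ (sym d₁))))

label : ℕ → Fin 4
label 0               = zero
label 1               = zero
label (suc (suc i))   = next (label i)

label-+8 : ∀ i → label (8 + i) ≡ label i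
label-+8 i = next⁴ (label i)

arc : ℕ → ℕ → Fin 4 → Fin 4 → Bool
arc p q a b = if p <ᵇ q then follows a b else ((q <ᵇ p) ∧ follows b a)

link : ℕ → ℕ → Bool
link p q = arc p q (label p) (label q)

-- A record rather than link p q ≡ true, so that p and q can be inferred from a proof.
infix 4 _⇄_
record _⇄_ (p q : ℕ) : Set where
  constructor joined
  field linked : link p q ≡ true
open _⇄_

<⇒<ᵇ≡true : ∀ {p q} → p < q → (p <ᵇ q) ≡ true
<⇒<ᵇ≡true p<q = Equivalence.to T-≡ (<⇒<ᵇ p<q)

arc-sym : ∀ p q a b → arc p q a b ≡ arc q p b a
arc-sym p q a b with p <ᵇ q in p<q | q <ᵇ p in q<p
... | true  | true  = ⊥-elim (<-asym (<ᵇ⇒< p q (Equivalence.from T-≡ p<q))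
                                     (<ᵇ⇒< q p (Equivalence.from T-≡ q<p)))
... | true  | false = refl
... | false | true  = refl
... | false | false = refl

arc-same : ∀ p q a → arc p q a a ≡ false
arc-same p q a with p <ᵇ q | q <ᵇ p
... | true  | _     = follows-irrefl a
... | false | true  = follows-irrefl a
... | false | false = refl

link-sym : ∀ p q → link p q ≡ link q p
link-sym p q = arc-sym p q (label p) (label q)

⇄-sym : ∀ {p q} → p ⇄ q → q ⇄ p
⇄-sym {p} {q} (joined h) = joined (trans (link-sym q p) h)

link-irrefl : ∀ p → link p p ≡ false
link-irrefl p = arc-same p p (label p)

link-< : ∀ {p q} → p < q → link p q ≡ follows (label p) (label q)
link-< {p} {q} p<q with p <ᵇ q | <⇒<ᵇ≡true p<q
... | true | refl = refl

forward : ∀ {p q} → p < q → follows (label p) (label q) ≡ true → p ⇄ q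
forward p<q f = joined (trans (link-< p<q) f)

one-step : ∀ {p q} → p < q → label q ≡ next (label p) → p ⇄ q
one-step {p} p<q e = forward p<q (trans (cong (follows (label p)) e) (follows-next (label p)))

two-steps : ∀ {p q} → p < q → label q ≡ next (next (label p)) → p ⇄ q
two-steps {p} p<q e = forward p<q (trans (cong (follows (label p)) e) (follows-next² (label p)))

⇄⇒label≢ : ∀ {p q} → p ⇄ q → label p ≢ label q
⇄⇒label≢ {p} {q} (joined h) e
  with trans (sym h) (trans (cong (arc p q (label p)) (sym e)) (arc-same p q (label p)))
... | ()

⇄⇒≢ : ∀ {p q} → p ⇄ q → p ≢ q
⇄⇒≢ {p} (joined h) refl with trans (sym h) (link-irrefl p)
... | ()

⇄-from-below : ∀ {p q} → p ≤ q → p ⇄ q → follows (label p) (label q) ≡ true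
⇄-from-below p≤q h = trans (sym (link-< (≤∧≢⇒< p≤q (⇄⇒≢ h)))) (linked h)

no-triangle-below : ∀ {x y z w} → x ≤ w → y ≤ w → z ≤ w →
  x ⇄ y → x ⇄ z → y ⇄ z → x ⇄ w → y ⇄ w → z ⇄ w → ⊥
no-triangle-below x≤w y≤w z≤w xy xz yz xw yw zw
  with two-predecessors (⇄-from-below x≤w xw) (⇄-from-below y≤w yw) (⇄-from-below z≤w zw)
... | inj₁ x≈y        = ⇄⇒label≢ xy x≈y
... | inj₂ (inj₁ x≈z) = ⇄⇒label≢ xz x≈z
... | inj₂ (inj₂ y≈z) = ⇄⇒label≢ yz y≈z

Dominates : ℕ → ℕ → ℕ → ℕ → Set
Dominates m x y z = x ≤ m × y ≤ m × z ≤ m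

maximum-of-four : ∀ x y z w →
  Dominates x y z w ⊎ Dominates y x z w ⊎ Dominates z x y w ⊎ Dominates w x y z
maximum-of-four x y z w = pick (⊔-sel (x ⊔ y ⊔ z) w) (⊔-sel (x ⊔ y) z) (⊔-sel x y)
  where
  m = x ⊔ y ⊔ z ⊔ w
  x≤m = ≤-trans (m≤m⊔n x y) (≤-trans (m≤m⊔n (x ⊔ y) z) (m≤m⊔n (x ⊔ y ⊔ z) w))
  y≤m = ≤-trans (m≤n⊔m x y) (≤-trans (m≤m⊔n (x ⊔ y) z) (m≤m⊔n (x ⊔ y ⊔ z) w))
  z≤m = ≤-trans (m≤n⊔m (x ⊔ y) z) (m≤m⊔n (x ⊔ y ⊔ z) w)
  w≤m = m≤n⊔m (x ⊔ y ⊔ z) w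
  below : ∀ {u v} → m ≡ v → u ≤ m → u ≤ v
  below m≡v u≤m = subst (_ ≤_) m≡v u≤m
  pick : m ≡ x ⊔ y ⊔ z ⊎ m ≡ w → x ⊔ y ⊔ z ≡ x ⊔ y ⊎ x ⊔ y ⊔ z ≡ z →
         x ⊔ y ≡ x ⊎ x ⊔ y ≡ y →
    Dominates x y z w ⊎ Dominates y x z w ⊎ Dominates z x y w ⊎ Dominates w x y z
  pick (inj₂ e) _ _ = inj₂ (inj₂ (inj₂ (below e x≤m , below e y≤m , below e z≤m)))
  pick (inj₁ e) (inj₂ e′) _ = inj₂ (inj₂ (inj₁ (below e″ x≤m , below e″ y≤m , below e″ w≤m)))
    where e″ = trans e e′
  pick (inj₁ e) (inj₁ e′) (inj₁ e‴) = inj₁ (below e″ y≤m , below e″ z≤m , below e″ w≤m)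
    where e″ = trans e (trans e′ e‴)
  pick (inj₁ e) (inj₁ e′) (inj₂ e‴) = inj₂ (inj₁ (below e″ x≤m , below e″ z≤m , below e″ w≤m))
    where e″ = trans e (trans e′ e‴)

no-K4 : ∀ {x y z w} → x ⇄ y → x ⇄ z → x ⇄ w → y ⇄ z → y ⇄ w → z ⇄ w → ⊥
no-K4 {x} {y} {z} {w} xy xz xw yz yw zw with maximum-of-four x y z w
... | inj₁ (y≤ , z≤ , w≤) =
  no-triangle-below y≤ z≤ w≤ yz yw zw (⇄-sym xy) (⇄-sym xz) (⇄-sym xw)
... | inj₂ (inj₁ (x≤ , z≤ , w≤)) =
  no-triangle-below x≤ z≤ w≤ xz xw zw xy (⇄-sym yz) (⇄-sym yw)
... | inj₂ (inj₂ (inj₁ (x≤ , y≤ , w≤))) =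
  no-triangle-below x≤ y≤ w≤ xy xw yw xz yz (⇄-sym zw)
... | inj₂ (inj₂ (inj₂ (x≤ , y≤ , z≤))) =
  no-triangle-below x≤ y≤ z≤ xy xz yz xw yw zw

pairStart : ℕ → ℕ
pairStart 0             = 0
pairStart 1             = 0
pairStart (suc (suc i)) = 2 + pairStart i

pairStart-≤ : ∀ i → pairStart i ≤ i
pairStart-≤ 0             = z≤n
pairStart-≤ 1             = z≤n
pairStart-≤ (suc (suc i)) = s≤s (s≤s (pairStart-≤ i))

<-nextPair : ∀ i → i < 2 + pairStart i
<-nextPair 0             = s≤s z≤n
<-nextPair 1             = s≤s (s≤s z≤n)
<-nextPair (suc (suc i)) = s≤s (s≤s (<-nextPair i))

label-pairStart : ∀ i → label (pairStart i) ≡ label i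
label-pairStart 0             = refl
label-pairStart 1             = refl
label-pairStart (suc (suc i)) = cong next (label-pairStart i)

<-2+ : ∀ i → i < 2 + i
<-2+ i = s≤s (n≤1+n i)

next-label≡0⇒5≤ : ∀ q → next (label q) ≡ zero → 5 ≤ q
next-label≡0⇒5≤ 0 ()
next-label≡0⇒5≤ 1 ()
next-label≡0⇒5≤ 2 ()
next-label≡0⇒5≤ 3 ()
next-label≡0⇒5≤ 4 ()
next-label≡0⇒5≤ 5 ()
next-label≡0⇒5≤ (suc (suc (suc (suc (suc (suc q)))))) _ = s≤s (s≤s (s≤s (s≤s (s≤s z≤n))))

two-pairs-between : ∀ p q → p < q → next (label q) ≡ label p → 4 + pairStart p < q
two-pairs-between 0 q _ e = next-label≡0⇒5≤ q e
two-pairs-between 1 q _ e = next-label≡0⇒5≤ q e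
two-pairs-between (suc (suc p)) (suc (suc q)) (s≤s (s≤s p<q)) e =
  s≤s (s≤s (two-pairs-between p q p<q (next-injective e)))

positions : ℕ → ℕ
positions k = 6 + k * 8

-- Distance from the start of a pair labelled a to the end of the next pair labelled 2; room holds
-- because the positions end with a pair labelled 2.
reach : Fin 4 → ℕ
reach zero                   = 6
reach (suc zero)             = 4
reach (suc (suc zero))       = 2
reach (suc (suc (suc zero))) = 8

≤-firstBlocks : ∀ {m} k → T (m ≤ᵇ 14) → m ≤ positions (suc k)
≤-firstBlocks {m} k m≤14 = ≤-trans (≤ᵇ⇒≤ m 14 m≤14) (m≤m+n 14 (k * 8))

room : ∀ k q → q < positions k → reach (label q) + pairStart q ≤ positions k
room zero 0 _ = ≤-refl
room zero 1 _ = ≤-refl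
room zero 2 _ = ≤-refl
room zero 3 _ = ≤-refl
room zero 4 _ = ≤-refl
room zero 5 _ = ≤-refl
room zero (suc (suc (suc (suc (suc (suc _)))))) (s≤s (s≤s (s≤s (s≤s (s≤s (s≤s ()))))))
room (suc k) 0 _ = ≤-firstBlocks k tt
room (suc k) 1 _ = ≤-firstBlocks k tt
room (suc k) 2 _ = ≤-firstBlocks k tt
room (suc k) 3 _ = ≤-firstBlocks k tt
room (suc k) 4 _ = ≤-firstBlocks k tt
room (suc k) 5 _ = ≤-firstBlocks k tt
room (suc k) 6 _ = ≤-firstBlocks k tt
room (suc k) 7 _ = ≤-firstBlocks k tt
room (suc k) (suc (suc (suc (suc (suc (suc (suc (suc q))))))))
     (s≤s (s≤s (s≤s (s≤s (s≤s (s≤s (s≤s (s≤s q<n)))))))) = begin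
  reach (label (8 + q)) + (8 + pairStart q) ≡⟨ cong ((_+ (8 + pairStart q)) ∘ reach) (label-+8 q) ⟩
  reach (label q) + (8 + pairStart q)       ≡⟨ x∙yz≈y∙xz (reach (label q)) 8 (pairStart q) ⟩
  8 + (reach (label q) + pairStart q)       ≤⟨ +-monoʳ-≤ 8 (room k q q<n) ⟩
  8 + positions k                           ∎
  where open ≤-Reasoning

CommonLink : ℕ → ℕ → ℕ → ℕ → Set
CommonLink p q y z = p ⇄ y × p ⇄ z × q ⇄ y × q ⇄ z × y ⇄ z

between : ∀ {p y z q} → p < y → y < z → z < q →
  label y ≡ next (label p) → label z ≡ next (label y) → label q ≡ next (label z) →
  CommonLink p q y z
between p<y y<z z<q ly lz lq =
  one-step p<y ly , two-steps (<-trans p<y y<z) (trans lz (cong next ly)) ,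
  ⇄-sym (two-steps (<-trans y<z z<q) (trans lq (cong next lz))) , ⇄-sym (one-step z<q lq) ,
  one-step y<z lz

after : ∀ {p q y z} → p < q → q < y → y < z →
  label q ≡ label p → label y ≡ next (label q) → label z ≡ next (label y) → CommonLink p q y z
after p<q q<y y<z lq ly lz =
  one-step p<y (trans ly (cong next lq)) ,
  two-steps (<-trans p<y y<z) (trans lz (cong next (trans ly (cong next lq)))) ,
  one-step q<y ly , two-steps (<-trans q<y y<z) (trans lz (cong next ly)) ,
  one-step y<z lz
  where p<y = <-trans p<q q<y

before : ∀ {y z p q} → y < z → z < p → p < q →
  label z ≡ next (label y) → label p ≡ next (label z) → label q ≡ label p → CommonLink p q y z
before y<z z<p p<q lz lp lq =
  ⇄-sym (two-steps (<-trans y<z z<p) (trans lp (cong next lz))) , ⇄-sym (one-step z<p lp) ,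
  ⇄-sym (two-steps (<-trans y<z z<q) (trans lq (trans lp (cong next lz)))) ,
  ⇄-sym (one-step z<q (trans lq lp)) ,
  one-step y<z lz
  where z<q = <-trans z<p p<q

around : ∀ {z p q y} → z < p → p < q → q < y →
  label p ≡ next (label z) → label q ≡ label p → label y ≡ next (label q) → CommonLink p q y z
around z<p p<q q<y lp lq ly =
  one-step (<-trans p<q q<y) (trans ly (cong next lq)) , ⇄-sym (one-step z<p lp) ,
  one-step q<y ly , ⇄-sym (one-step (<-trans z<p p<q) (trans lq lp)) ,
  ⇄-sym (two-steps (<-trans z<p (<-trans p<q q<y)) (trans ly (cong next (trans lq lp))))

CommonLinkBelow : ℕ → ℕ → ℕ → Set
CommonLinkBelow n p q = Σ ℕ λ y → Σ ℕ λ z → y < n × z < n × CommonLink p q y z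

CommonLinkBelow-swap : ∀ {n p q} → CommonLinkBelow n p q → CommonLinkBelow n q p
CommonLinkBelow-swap (y , z , y<n , z<n , py , pz , qy , qz , yz) = y , z , y<n , z<n , qy , qz , py , pz , yz

preceding-label : ∀ {n p q} → p < q → q < n → next (label q) ≡ label p → CommonLinkBelow n p q
preceding-label {n} {p} {q} p<q q<n back =
  2 + pairStart p , 4 + pairStart p , <-trans (<-2+ _) z<n , z<n ,
  between (<-nextPair p) (<-2+ _) z<q (cong next (label-pairStart p)) refl lq
  where
  z<q = two-pairs-between p q p<q back
  z<n = <-trans z<q q<n
  lq : label q ≡ next (next (next (label (pairStart p))))
  lq = trans (sym (next⁴ (label q))) (cong (next ∘ next ∘ next) (trans back (sym (label-pairStart p))))

in-first-pair : ∀ k {p q} → p < q → q < positions k → label q ≡ label p → label q ≡ zero →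
  CommonLinkBelow (positions k) p q
in-first-pair k {p} {q} p<q q<n same zero-label =
  2 + pairStart q , 4 + pairStart q , <-trans (<-2+ _) z<n , z<n ,
  after p<q (<-nextPair q) (<-2+ _) same (cong next (label-pairStart q)) refl
  where
  z<n : 4 + pairStart q < positions k
  z<n = ≤-trans (n≤1+n _) (subst (λ a → reach a + pairStart q ≤ positions k) zero-label
                                 (room k q q<n))

in-second-pair : ∀ k {p q} → 0 < p → p < q → q < positions k →
  label p ≡ next zero → label q ≡ label p →
  CommonLinkBelow (positions k) p q
in-second-pair k {p} {q} 0<p p<q q<n lp same =
  2 + pairStart q , 0 , y<n , <-trans (<-trans 0<p p<q) q<n ,
  around 0<p p<q (<-nextPair q) lp same (cong next (label-pairStart q))
  where
  y<n : 2 + pairStart q < positions k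
  y<n = ≤-trans (n≤1+n _) (subst (λ a → reach a + pairStart q ≤ positions k) (trans same lp)
                                 (room k q q<n))

-- From position 4 on, the two pairs preceding p complete p and q; before that, room provides
-- witnesses after q.
same-label : ∀ k p {q} → p < q → q < positions k → label q ≡ label p →
  CommonLinkBelow (positions k) p q
same-label k 0 p<q q<n same = in-first-pair k p<q q<n same same
same-label k 1 p<q q<n same = in-first-pair k p<q q<n same same
same-label k 2 p<q q<n same = in-second-pair k (s≤s z≤n) p<q q<n refl same
same-label k 3 p<q q<n same = in-second-pair k (s≤s z≤n) p<q q<n refl same
same-label k (suc (suc (suc (suc r)))) p<q q<n same =
  pairStart r , 2 + pairStart r , <-trans (<-trans y<z z<p) q′<n , <-trans z<p q′<n ,
  before y<z z<p p<q refl (cong (next ∘ next) (sym (label-pairStart r))) same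
  where
  y<z = <-2+ (pairStart r)
  z<p = s≤s (s≤s (s≤s (≤-trans (pairStart-≤ r) (n≤1+n r))))
  q′<n = <-trans p<q q<n

unlinked-pair : ∀ k {p q} → p < q → q < positions k → link p q ≡ false →
  CommonLinkBelow (positions k) p q
unlinked-pair k {p} {q} p<q q<n p≁q with follows-false (label p) (label q) (trans (sym (link-< p<q)) p≁q)
... | inj₁ same = same-label k p p<q q<n same
... | inj₂ back = preceding-label p<q q<n back

cyclicGraph : ∀ n → Graph n
cyclicGraph n = record
  { adj    = λ x y → link (toℕ x) (toℕ y)
  ; sym    = λ x y → link-sym (toℕ x) (toℕ y)
  ; irrefl = λ x → link-irrefl (toℕ x)
  }

cyclic-K4-free : ∀ n → ¬ HasK4 (adj (cyclicGraph n))
cyclic-K4-free n (x , y , z , w , _ , _ , _ , _ , _ , _ , xy , xz , xw , yz , yw , zw) =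
  no-K4 (edge x y xy) (edge x z xz) (edge x w xw) (edge y z yz) (edge y w yw) (edge z w zw)
  where
  edge : ∀ a b → a ~[ cyclicGraph n ] b → toℕ a ⇄ toℕ b
  edge a b = joined

toCommonEdge : ∀ {n} {u v : Fin n} →
  CommonLinkBelow n (toℕ u) (toℕ v) → CommonEdge (cyclicGraph n) u v
toCommonEdge (y , z , y<n , z<n , uy , uz , vy , vz , yz) =
  fromℕ< y<n , fromℕ< z<n ,
  at refl ỹ uy , at refl z̃ uz , at refl ỹ vy , at refl z̃ vz , at ỹ z̃ yz
  where
  ỹ = toℕ-fromℕ< y<n
  z̃ = toℕ-fromℕ< z<n
  at : ∀ {p q p′ q′} → p′ ≡ p → q′ ≡ q → p ⇄ q → link p′ q′ ≡ true
  at refl refl h = linked h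

cyclic-commonEdge : ∀ k (u v : Fin (positions k)) → u ≢ v → link (toℕ u) (toℕ v) ≡ false →
  CommonEdge (cyclicGraph (positions k)) u v
cyclic-commonEdge k u v u≢v u≁v with <-cmp (toℕ u) (toℕ v)
... | tri< u<v _ _ = toCommonEdge (unlinked-pair k u<v (toℕ<n v) u≁v)
... | tri≈ _ u≡v _ = ⊥-elim (u≢v (toℕ-injective u≡v))
... | tri> _ _ v<u = toCommonEdge (CommonLinkBelow-swap
                       (unlinked-pair k v<u (toℕ<n u) (trans (link-sym (toℕ v) (toℕ u)) u≁v)))

countBelow : ℕ → (ℕ → Bool) → ℕ
countBelow n f = count {n} (f ∘ toℕ)

countBelow-+ : ∀ m n f → countBelow (m + n) f ≡ countBelow m f + countBelow n (λ i → f (m + i))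
countBelow-+ zero    n f = refl
countBelow-+ (suc m) n f =
  trans (cong (bit (f 0) +_) (countBelow-+ m n (f ∘ suc))) (sym (+-assoc (bit (f 0)) _ _))

countBelow-cong : ∀ n {f g : ℕ → Bool} → (∀ i → f i ≡ g i) → countBelow n f ≡ countBelow n g
countBelow-cong n f≗g = count-cong {n} (f≗g ∘ toℕ)

successors-per-block : ∀ a → countBelow 8 (λ i → follows a (label i)) ≡ 4
successors-per-block = fin4-cases refl refl refl refl

predecessors-per-block : ∀ a → countBelow 8 (λ i → follows (label i) a) ≡ 4
predecessors-per-block = fin4-cases refl refl refl refl

successors : ∀ k a →
  countBelow (positions k) (follows a ∘ label) ≡ k * 4 + countBelow 6 (follows a ∘ label)
successors zero    a = refl
successors (suc k) a = begin
  countBelow (8 + positions k) (follows a ∘ label)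
    ≡⟨ countBelow-+ 8 (positions k) (follows a ∘ label) ⟩
  countBelow 8 (follows a ∘ label) + countBelow (positions k) (λ i → follows a (label (8 + i)))
    ≡⟨ cong₂ _+_ (successors-per-block a)
                 (countBelow-cong (positions k) (cong (follows a) ∘ label-+8)) ⟩
  4 + countBelow (positions k) (follows a ∘ label)
    ≡⟨ cong (4 +_) (successors k a) ⟩
  4 + (k * 4 + countBelow 6 (follows a ∘ label)) ∎
  where open ≡-Reasoning

link-+8 : ∀ p q → link (8 + p) (8 + q) ≡ link p q
link-+8 p q = cong₂ (arc p q) (label-+8 p) (label-+8 q)

first-block-neighbours : ∀ p → T (p <ᵇ 8) →
  countBelow 8 (link p) + countBelow 6 (λ i → follows (label p) (label i)) ≡ 8
first-block-neighbours 0 _ = refl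
first-block-neighbours 1 _ = refl
first-block-neighbours 2 _ = refl
first-block-neighbours 3 _ = refl
first-block-neighbours 4 _ = refl
first-block-neighbours 5 _ = refl
first-block-neighbours 6 _ = refl
first-block-neighbours 7 _ = refl

degree-in-first-block : ∀ k p → T (p <ᵇ 8) → countBelow (8 + positions k) (link p) ≡ 8 + k * 4
degree-in-first-block k p p<8 = begin
  countBelow (8 + positions k) (link p)
    ≡⟨ countBelow-+ 8 (positions k) (link p) ⟩
  countBelow 8 (link p) + countBelow (positions k) (λ i → link p (8 + i))
    ≡⟨ cong (countBelow 8 (link p) +_)
            (trans (countBelow-cong (positions k) later) (successors k (label p))) ⟩
  countBelow 8 (link p) + (k * 4 + countBelow 6 (follows (label p) ∘ label))
    ≡⟨ x∙yz≈xz∙y (countBelow 8 (link p)) (k * 4) _ ⟩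
  countBelow 8 (link p) + countBelow 6 (follows (label p) ∘ label) + k * 4
    ≡⟨ cong (_+ k * 4) (first-block-neighbours p p<8) ⟩
  8 + k * 4 ∎
  where
  open ≡-Reasoning
  later : ∀ i → link p (8 + i) ≡ follows (label p) (label i)
  later i = trans (link-< (<-≤-trans (<ᵇ⇒< p 8 p<8) (m≤m+n 8 i)))
                  (cong (follows (label p)) (label-+8 i))

degree-cyclic : ∀ k p → p < positions k → countBelow (positions k) (link p) ≡ 4 + k * 4
degree-cyclic zero 0 _ = refl
degree-cyclic zero 1 _ = refl
degree-cyclic zero 2 _ = refl
degree-cyclic zero 3 _ = refl
degree-cyclic zero 4 _ = refl
degree-cyclic zero 5 _ = refl
degree-cyclic zero (suc (suc (suc (suc (suc (suc _)))))) (s≤s (s≤s (s≤s (s≤s (s≤s (s≤s ()))))))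
degree-cyclic (suc k) 0 _ = degree-in-first-block k 0 tt
degree-cyclic (suc k) 1 _ = degree-in-first-block k 1 tt
degree-cyclic (suc k) 2 _ = degree-in-first-block k 2 tt
degree-cyclic (suc k) 3 _ = degree-in-first-block k 3 tt
degree-cyclic (suc k) 4 _ = degree-in-first-block k 4 tt
degree-cyclic (suc k) 5 _ = degree-in-first-block k 5 tt
degree-cyclic (suc k) 6 _ = degree-in-first-block k 6 tt
degree-cyclic (suc k) 7 _ = degree-in-first-block k 7 tt
degree-cyclic (suc k) (suc (suc (suc (suc (suc (suc (suc (suc p))))))))
              (s≤s (s≤s (s≤s (s≤s (s≤s (s≤s (s≤s (s≤s p<n)))))))) = begin
  countBelow (8 + positions k) (link (8 + p))
    ≡⟨ countBelow-+ 8 (positions k) (link (8 + p)) ⟩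
  countBelow 8 (link (8 + p)) + countBelow (positions k) (λ i → link (8 + p) (8 + i))
    ≡⟨ cong₂ _+_ (predecessors-per-block (label (8 + p)))
                 (countBelow-cong (positions k) (link-+8 p)) ⟩
  4 + countBelow (positions k) (link p)
    ≡⟨ cong (4 +_) (degree-cyclic k p p<n) ⟩
  4 + (4 + k * 4) ∎
  where open ≡-Reasoning

cyclic-regular : ∀ k → Regular (cyclicGraph (positions k))
cyclic-regular k = 4 + k * 4 , λ v →
  trans (degree≡count (cyclicGraph (positions k)) v) (degree-cyclic k (toℕ v) (toℕ<n v))

cyclic-K4Saturated : ∀ k → K4Saturated (cyclicGraph (positions k))
cyclic-K4Saturated k =
  commonEdges⇒K4Saturated (cyclicGraph (positions k)) (cyclic-K4-free (positions k))
    (cyclic-commonEdge k)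

cyclic-regularK4Saturated : ∀ k → RegularK4Saturated (positions k)
cyclic-regularK4Saturated k = cyclicGraph (positions k) , cyclic-regular k , cyclic-K4Saturated k

remainder-decomposition : ∀ n d .{{_ : NonZero d}} {r} → n % d ≡ r → n ≡ r + n / d * d
remainder-decomposition n d n%d≡r = trans (m≡m%n+[m/n]*n n d) (cong (_+ n / d * d) n%d≡r)

proposition4p1 : (n : ℕ) → 0 < n →
    ((n % 8 ≡ 6) ⊎ (n % 8 ≡ 0) ⊎ (n % 17 ≡ 0)) →
    Σ (Graph n) λ G → Regular G × K4Saturated G
proposition4p1 n _ (inj₁ n%8≡6) =
  subst RegularK4Saturated (sym (remainder-decomposition n 8 n%8≡6)) (cyclic-regularK4Saturated (n / 8))
proposition4p1 n _ (inj₂ (inj₁ n%8≡0)) =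
  subst RegularK4Saturated (sym (remainder-decomposition n 8 n%8≡0)) (ThreeJoinC₅.blowUps (n / 8))
proposition4p1 n _ (inj₂ (inj₂ n%17≡0)) =
  subst RegularK4Saturated (sym (remainder-decomposition n 17 n%17≡0)) (Paley₁₇.blowUps (n / 17))
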